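{- Let $G$ be a finitely generated Abelian group, $e\in G$ an element of order $2$, $U\ge1$, $\Omega\subset\{ -1,1\}^U$ with $-\Omega=\Omega$, and $L>2U+4$. Then the property of a tuple of functions $\alpha_1,\dots,\alpha_U:G\to\mathbb{Z}/L\mathbb{Z}$ that each $\alpha_u$ is $e$-boolean and $(\alpha_1(x),\dots,\alpha_U(x))\in\Omega$ for all $x\in G$ is weakly expressible.
   Context: Here $\{ -1,1\}$ is viewed inside $\mathbb{Z}/L\mathbb{Z}$. A function $\alpha:G\to\mathbb{Z}/L\mathbb{Z}$ is $e$-boolean if it takes values in $\{ -1,+1\}$ and $\alpha(x+e)=-\alpha(x)$ for all $x\in G$. For $G$ finitely generated Abelian and $H$ finite Abelian, a $(G,H)$-property is a set $P$ of functions $\alpha:G\to H$. It is expressible if there exist $M\in\mathbb{N}$, and for $i=1,\dots,M$ numbers $J_i$, sets $E'_i\subset H$, shifts $h_{i,j}\in G$ and sets $E_{i,j}\subset H$ ($j\le J_i$), such that $\alpha\in P$ iff for all $i$ and $x\in G$ the sets $\alpha(x+h_{i,j})+E_{i,j}$ ($j=1,\dots,J_i$) are pairwise disjoint with union $E'_i$. A property of a tuple $(\alpha_u:G\to H_u)_{u\in\mathcal{U}}$ (finite Abelian $H_u$) is identified with a $(G,\prod_uH_u)$-property. Such a property $P$ is weakly expressible if there is an expressible property $P^*$ of tuples indexed by $\mathcal{U}\uplus\mathcal{U}^*$ (finite Abelian targets) such that a tuple obeys $P$ iff it has an extension to $\mathcal{U}\uplus\mathcal{U}^*$ obeying $P^*$.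 -}

module Defs where

open import Level using (0ℓ)
open import Data.Nat using (ℕ; zero; suc; _%_; NonZero; _∸_)
open import Data.Nat.DivMod using (m%n<n)
open import Data.Integer using (ℤ; +_; -[1+_])
open import Data.Fin using (Fin; zero; suc; toℕ; fromℕ<)
open import Data.Vec using (Vec; tabulate)
open import Data.Product using (Σ; ∃; ∃-syntax; _×_; _,_)
open import Data.Unit using (⊤; tt)
open import Data.Sum using (_⊎_)
open import Algebra.Core using (Op₁; Op₂)
open import Algebra.Structures using (IsAbelianGroup)
open import Relation.Binary.PropositionalEquality using (_≡_; _≢_)
open import Relation.Nullary using (¬_)
open import Function.Bundles using (_↔_; _⇔_)

natMul : {A : Set} → Op₂ A → A → ℕ → A → A
natMul _∙_ ε zero    g = ε
natMul _∙_ ε (suc n) g = g ∙ natMul _∙_ ε n g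

intMul : {A : Set} → Op₂ A → A → Op₁ A → ℤ → A → A
intMul _∙_ ε _⁻¹ (+ n)     g = natMul _∙_ ε n g
intMul _∙_ ε _⁻¹ -[1+ n ]  g = (natMul _∙_ ε (suc n) g) ⁻¹

linComb : {A : Set} → Op₂ A → A → Op₁ A → (n : ℕ) → (Fin n → ℤ) → (Fin n → A) → A
linComb _∙_ ε _⁻¹ zero    c g = ε
linComb _∙_ ε _⁻¹ (suc n) c g =
  intMul _∙_ ε _⁻¹ (c zero) (g zero) ∙ linComb _∙_ ε _⁻¹ n (λ i → c (suc i)) (λ i → g (suc i))

record FGAbGroup : Set₁ where
  field
    Carrier        : Set
    _∙_            : Op₂ Carrier
    ε              : Carrier
    _⁻¹            : Op₁ Carrier
    isAbelianGroup : IsAbelianGroup _≡_ _∙_ ε _⁻¹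
    nGen           : ℕ
    gen            : Fin nGen → Carrier
    generates      : ∀ g → ∃[ c ] g ≡ linComb _∙_ ε _⁻¹ nGen c gen

record FinAbGroup : Set₁ where
  field
    Carrier        : Set
    _∙_            : Op₂ Carrier
    ε              : Carrier
    _⁻¹            : Op₁ Carrier
    isAbelianGroup : IsAbelianGroup _≡_ _∙_ ε _⁻¹
    card           : ℕ
    enum           : Fin card ↔ Carrier

HasOrder2 : (G : FGAbGroup) → FGAbGroup.Carrier G → Set
HasOrder2 G e = e ≢ ε × (e ∙ e) ≡ ε
  where open FGAbGroup G

-- Target data: a carrier with its addition (only addition is used by the
-- notion of expressibility: translates a + E)

record Tgt : Set₁ where
  field
    Carrier : Set
    _⊕_     : Op₂ Carrier

finTgt : FinAbGroup → Tgt
finTgt H = record { Carrier = FinAbGroup.Carrier H ; _⊕_ = FinAbGroup._∙_ H }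

ProdC : (n : ℕ) → (Fin n → Tgt) → Set
ProdC zero    H = ⊤
ProdC (suc n) H = Tgt.Carrier (H zero) × ProdC n (λ i → H (suc i))

prodAdd : (n : ℕ) (H : Fin n → Tgt) → Op₂ (ProdC n H)
prodAdd zero    H tt tt = tt
prodAdd (suc n) H (a , as) (b , bs) = Tgt._⊕_ (H zero) a b , prodAdd n (λ i → H (suc i)) as bs

ProdT : (n : ℕ) → (Fin n → Tgt) → Tgt
ProdT n H = record { Carrier = ProdC n H ; _⊕_ = prodAdd n H }

_×T_ : Tgt → Tgt → Tgt
A ×T B = record { Carrier = Tgt.Carrier A × Tgt.Carrier B
                ; _⊕_ = λ { (a , b) (a' , b') → Tgt._⊕_ A a a' , Tgt._⊕_ B b b' } }

pack : (n : ℕ) (H : Fin n → Tgt) → ((i : Fin n) → Tgt.Carrier (H i)) → ProdC n H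
pack zero    H y = tt
pack (suc n) H y = y zero , pack n (λ i → H (suc i)) (λ i → y (suc i))

Subset : Set → Set₁
Subset A = A → Set

InTranslate : (T : Tgt) → Tgt.Carrier T → Subset (Tgt.Carrier T) → Tgt.Carrier T → Set
InTranslate T a E y = ∃[ z ] (E z × y ≡ Tgt._⊕_ T a z)

record ExprData (G : FGAbGroup) (T : Tgt) : Set₁ where
  field
    M  : ℕ
    J  : Fin M → ℕ
    E' : Fin M → Subset (Tgt.Carrier T)
    h  : (i : Fin M) → Fin (J i) → FGAbGroup.Carrier G
    E  : (i : Fin M) → Fin (J i) → Subset (Tgt.Carrier T)

Tiles : (G : FGAbGroup) (T : Tgt) (D : ExprData G T)
        (α : FGAbGroup.Carrier G → Tgt.Carrier T) → Fin (ExprData.M D) → FGAbGroup.Carrier G → Set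
Tiles G T D α i x =
    (∀ y → E' i y ⇔ (∃[ j ] S j y))
  × (∀ j j' → j ≢ j' → ∀ y → ¬ (S j y × S j' y))
  where
    open ExprData D
    S : Fin (J i) → Subset (Tgt.Carrier T)
    S j = InTranslate T (α (FGAbGroup._∙_ G x (h i j))) (E i j)

Property : FGAbGroup → Tgt → Set₁
Property G T = (FGAbGroup.Carrier G → Tgt.Carrier T) → Set

Expressible : (G : FGAbGroup) (T : Tgt) → Property G T → Set₁
Expressible G T P =
  Σ (ExprData G T) λ D → ∀ α → P α ⇔ (∀ i x → Tiles G T D α i x)

Tuple : FGAbGroup → (U : ℕ) → (Fin U → Tgt) → Set
Tuple G U H = (u : Fin U) → FGAbGroup.Carrier G → Tgt.Carrier (H u)

TupleProperty : FGAbGroup → (U : ℕ) → (Fin U → Tgt) → Set₁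
TupleProperty G U H = Tuple G U H → Set

packTuple : (G : FGAbGroup) (U : ℕ) (H : Fin U → Tgt) → Tuple G U H →
            FGAbGroup.Carrier G → ProdC U H
packTuple G U H α x = pack U H (λ u → α u x)

-- weak expressibility: extra functions indexed by U* = Fin m with finite
-- Abelian targets H*; the product over U ⊎ U* is ∏_U H_u × ∏_{U*} H*_v
WeaklyExpressible : (G : FGAbGroup) (U : ℕ) (H : Fin U → Tgt) → TupleProperty G U H → Set₁
WeaklyExpressible G U H P =
  Σ ℕ λ m → Σ (Fin m → FinAbGroup) λ H* →
  Σ (Property G (ProdT U H ×T ProdT m (λ v → finTgt (H* v)))) λ P* →
      Expressible G (ProdT U H ×T ProdT m (λ v → finTgt (H* v))) P*
    × (∀ α → P α ⇔ (∃[ β ] P* (λ x → packTuple G U H α x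
                                    , packTuple G m (λ v → finTgt (H* v)) β x)))

module _ (L : ℕ) {{_ : NonZero L}} where
  addZ : Op₂ (Fin L)
  addZ a b = fromℕ< (m%n<n (toℕ a + toℕ b) L)
    where open Data.Nat using (_+_)

  negZ : Op₁ (Fin L)
  negZ a = fromℕ< (m%n<n (L ∸ toℕ a) L)

  oneZ : Fin L
  oneZ = fromℕ< (m%n<n 1 L)

  minusOneZ : Fin L
  minusOneZ = negZ oneZ

  ZLT : Tgt
  ZLT = record { Carrier = Fin L ; _⊕_ = addZ }

data PM : Set where
  minus plus : PM

negPM : PM → PM
negPM minus = plus
negPM plus  = minus

pmZ : (L : ℕ) {{_ : NonZero L}} → PM → Fin L
pmZ L minus = minusOneZ L
pmZ L plus  = oneZ L

EBoolean : (G : FGAbGroup) (e : FGAbGroup.Carrier G) (L : ℕ) {{_ : NonZero L}} →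
           (FGAbGroup.Carrier G → Fin L) → Set
EBoolean G e L α =
  ∀ x → (α x ≡ oneZ L ⊎ α x ≡ minusOneZ L) × α (FGAbGroup._∙_ G x e) ≡ negZ L (α x)

BoolOmega : (G : FGAbGroup) (e : FGAbGroup.Carrier G) (U : ℕ) (Ω : Subset (Fin U → PM))
            (L : ℕ) {{_ : NonZero L}} → TupleProperty G U (λ _ → ZLT L)
BoolOmega G e U Ω L α =
    (∀ u → EBoolean G e L (α u))
  × (∀ x → ∃[ ω ] (Ω ω × (∀ u → α u x ≡ pmZ L (ω u))))

-- Record α(x) by its sign vector s(x) ∈ {±1}^U. For every k ∈ {±1}^U add U − 2 auxiliary
-- e-boolean functions β_{k,i} and require ℓ_k = Σ_u k_u α_u + Σ_i β_{k,i} = 0 unless k ∈ Ω.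
-- Both "±1-valued and negated by e" and "every ℓ_k with k ∉ Ω vanishes" say that translates
-- of a subgroup of the target by values of the tuple tile a fixed set, so they are expressible.
-- If s(x) ∈ Ω and k is not, then k ≠ ±s(x), so the agreement vector (k_u s_u(x))_u contains
-- both signs and U − 2 further signs can cancel its sum; normalising by its first entry makes
-- the choice odd under x ↦ x + e. Conversely, for k = s(x) the sum ℓ_k is U plus at most
-- U − 2 signs, an integer in (0, L), so ℓ_k ≠ 0 and s(x) must lie in Ω.
module Submission where

open import Defs
open import Data.Nat using (ℕ; _+_; _*_; _≤_; _<_; NonZero)
open import Data.Fin using (Fin)
open import Function using (_∘_)
open import Function.Bundles using (_⇔_)

open import Level using (0ℓ)
open import Function using (id)
open import Data.Nat using (zero; suc; _∸_; _%_; _^_; z≤n; s≤s; s≤s⁻¹; >-nonZero⁻¹)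
open import Data.Nat.Properties
open import Data.Nat.DivMod using (m%n<n; %-distribˡ-+; m<n⇒m%n≡m; n%n≡0)
open import Data.Fin
  using (zero; suc; toℕ; fromℕ<; finToFun; funToFin; combine; quotient; remainder; splitAt; join)
open import Data.Fin.Properties
  using (toℕ-injective; toℕ<n; toℕ-fromℕ<; finToFun-funToFin; remQuot-combine; splitAt-join)
open import Data.Product using (_×_; _,_; proj₁; proj₂; ∃-syntax)
open import Data.Sum using (_⊎_; inj₁; inj₂; [_,_]′)
open import Relation.Binary.PropositionalEquality
  using (_≡_; _≢_; refl; sym; trans; cong; cong₂; subst; isEquivalence; module ≡-Reasoning)
open import Relation.Nullary using (¬_; contradiction)
open import Algebra.Core using (Op₁; Op₂)
open import Algebra.Bundles using (AbelianGroup)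
open import Algebra.Structures using (IsAbelianGroup)
open import Function.Bundles using (mk⇔; Equivalence)
open import Function.Construct.Identity using (↔-id)
import Algebra.Properties.AbelianGroup as AbelianGroupProperties
import Algebra.Properties.CommutativeSemigroup as CommutativeSemigroupProperties
import Algebra.Properties.CommutativeMonoid.Sum as Summation

infixl 7 _⋆_

_⋆_ : PM → PM → PM
plus  ⋆ t = t
minus ⋆ t = negPM t

negPM-involutive : ∀ s → negPM (negPM s) ≡ s
negPM-involutive minus = refl
negPM-involutive plus  = refl

⋆-self : ∀ s → s ⋆ s ≡ plus
⋆-self minus = refl
⋆-self plus  = refl

negPM-⋆ : ∀ s t → negPM s ⋆ t ≡ negPM (s ⋆ t)
negPM-⋆ minus t = sym (negPM-involutive t)
negPM-⋆ plus  t = refl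

⋆-negPM : ∀ s t → s ⋆ negPM t ≡ negPM (s ⋆ t)
⋆-negPM minus t = refl
⋆-negPM plus  t = refl

⋆-transpose : ∀ s t {c} → s ⋆ t ≡ c → s ≡ c ⋆ t
⋆-transpose minus minus refl = refl
⋆-transpose minus plus  refl = refl
⋆-transpose plus  minus refl = refl
⋆-transpose plus  plus  refl = refl

isPlus : PM → ℕ
isPlus minus = 0
isPlus plus  = 1

#⁺ #⁻ : ∀ {n} → (Fin n → PM) → ℕ
#⁺ {zero}  f = 0
#⁺ {suc n} f = isPlus (f zero) + #⁺ (f ∘ suc)
#⁻ f = #⁺ (negPM ∘ f)

#⁺-cong : ∀ {n} {f g : Fin n → PM} → (∀ i → f i ≡ g i) → #⁺ f ≡ #⁺ g
#⁺-cong {zero}  eq = refl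
#⁺-cong {suc n} eq = cong₂ _+_ (cong isPlus (eq zero)) (#⁺-cong (eq ∘ suc))

#⁺+#⁻ : ∀ {n} (f : Fin n → PM) → #⁺ f + #⁻ f ≡ n
#⁺+#⁻ {zero}  f = refl
#⁺+#⁻ {suc n} f with f zero
... | minus = trans (+-suc _ _) (cong suc (#⁺+#⁻ (f ∘ suc)))
... | plus  = cong suc (#⁺+#⁻ (f ∘ suc))

#⁻-negPM : ∀ {n} (f : Fin n → PM) → #⁻ (negPM ∘ f) ≡ #⁺ f
#⁻-negPM f = #⁺-cong (negPM-involutive ∘ f)

#⁺-minus : ∀ n → #⁺ {n} (λ _ → minus) ≡ 0
#⁺-minus zero    = refl
#⁺-minus (suc n) = #⁺-minus n

#⁺-plus : ∀ n → #⁺ {n} (λ _ → plus) ≡ n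
#⁺-plus zero    = refl
#⁺-plus (suc n) = cong suc (#⁺-plus n)

#⁺≡0⇒minus : ∀ {n} (f : Fin n → PM) → #⁺ f ≡ 0 → ∀ i → f i ≡ minus
#⁺≡0⇒minus {suc n} f eq i with f zero in f₀
#⁺≡0⇒minus {suc n} f eq zero    | minus = f₀
#⁺≡0⇒minus {suc n} f eq (suc i) | minus = #⁺≡0⇒minus (f ∘ suc) eq i

#⁻≡0⇒plus : ∀ {n} (f : Fin n → PM) → #⁻ f ≡ 0 → ∀ i → f i ≡ plus
#⁻≡0⇒plus f eq i =
  trans (sym (negPM-involutive (f i))) (cong negPM (#⁺≡0⇒minus (negPM ∘ f) eq i))

constant⊎mixed : ∀ {n} (f : Fin n → PM) →
                 (∃[ c ] ∀ i → f i ≡ c) ⊎ (1 ≤ #⁺ f × 1 ≤ #⁻ f)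
constant⊎mixed f with #⁺ f in p | #⁻ f in q
... | zero  | _     = inj₁ (minus , #⁺≡0⇒minus f p)
... | suc _ | zero  = inj₁ (plus , #⁻≡0⇒plus f q)
... | suc _ | suc _ = inj₂ (s≤s z≤n , s≤s z≤n)

threshold : ∀ {n} → ℕ → Fin n → PM
threshold zero    _       = minus
threshold (suc c) zero    = plus
threshold (suc c) (suc i) = threshold c i

#⁺-threshold : ∀ {n c} → c ≤ n → #⁺ (threshold {n} c) ≡ c
#⁺-threshold {n}     {zero}  _         = #⁺-minus n
#⁺-threshold {suc n} {suc c} (s≤s c≤n) = cong suc (#⁺-threshold c≤n)

-- If w has p ≥ 1 entries + and q ≥ 1 entries −, then pivoted plus w has q − 1 entries + and
-- p − 1 entries −, so together they are balanced; pivoting by w zero makes the choice odd in w.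
pivoted : ∀ {n} → PM → (Fin (suc n) → PM) → Fin (n ∸ 1) → PM
pivoted s w = (s ⋆_) ∘ threshold (#⁻ ((s ⋆_) ∘ w) ∸ 1)

balancer : ∀ {n} → (Fin (suc n) → PM) → Fin (n ∸ 1) → PM
balancer w = pivoted (w zero) w

private
  balance-arith : ∀ {n p q x y} → p + q ≡ suc n → 1 ≤ p → 1 ≤ q →
                  x ≡ q ∸ 1 → x + y ≡ n ∸ 1 → p + x ≡ q + y
  balance-arith {p = suc p} {suc q} {y = y} p+q≡1+n _ _ refl q+y≡n-1 =
    cong suc (begin
      p + q ≡⟨ +-comm p q ⟩
      q + p ≡⟨ cong (q +_) (+-cancelˡ-≡ q p y (trans (+-comm q p) p+q≡q+y)) ⟩
      q + y ∎)
    where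
      open ≡-Reasoning
      p+q≡q+y : p + q ≡ q + y
      p+q≡q+y = trans (cong (_∸ 1) (trans (sym (+-suc p q)) (suc-injective p+q≡1+n)))
                      (sym q+y≡n-1)

  #⁺-threshold-pred : ∀ {n p q} → 1 ≤ p → p + q ≡ suc n →
                      #⁺ (threshold {n ∸ 1} (q ∸ 1)) ≡ q ∸ 1
  #⁺-threshold-pred {p = p} {q} p≥1 p+q≡1+n =
    #⁺-threshold (∸-monoˡ-≤ 1 (s≤s⁻¹ (≤-trans (+-monoˡ-≤ q p≥1) (≤-reflexive p+q≡1+n))))

pivoted-balances : ∀ {n} s (w : Fin (suc n) → PM) → 1 ≤ #⁺ w → 1 ≤ #⁻ w →
                   #⁺ w + #⁺ (pivoted s w) ≡ #⁻ w + #⁻ (pivoted s w)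
pivoted-balances plus w p≥1 q≥1 =
  balance-arith (#⁺+#⁻ w) p≥1 q≥1 (#⁺-threshold-pred p≥1 (#⁺+#⁻ w)) (#⁺+#⁻ (pivoted plus w))
pivoted-balances {n} minus w p≥1 q≥1 = sym (balance-arith q+p≡1+n q≥1 p≥1 x≡p-1 x+y≡n-1)
  where
    q+p≡1+n : #⁻ w + #⁺ w ≡ suc n
    q+p≡1+n = trans (+-comm (#⁻ w) (#⁺ w)) (#⁺+#⁻ w)
    b = pivoted minus w
    x≡p-1 : #⁻ b ≡ #⁺ w ∸ 1
    x≡p-1 = begin
      #⁻ b
        ≡⟨ #⁻-negPM (threshold {n ∸ 1} (#⁻ (negPM ∘ w) ∸ 1)) ⟩
      #⁺ (threshold {n ∸ 1} (#⁻ (negPM ∘ w) ∸ 1))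
        ≡⟨ cong (λ c → #⁺ (threshold {n ∸ 1} (c ∸ 1))) (#⁻-negPM w) ⟩
      #⁺ (threshold {n ∸ 1} (#⁺ w ∸ 1))
        ≡⟨ #⁺-threshold-pred q≥1 q+p≡1+n ⟩
      #⁺ w ∸ 1
        ∎
      where open ≡-Reasoning
    x+y≡n-1 : #⁻ b + #⁺ b ≡ n ∸ 1
    x+y≡n-1 = trans (+-comm (#⁻ b) (#⁺ b)) (#⁺+#⁻ b)

allPlus-unbalanced : ∀ {n n'} (b : Fin n' → PM) → n' < n →
                     #⁺ {n} (λ _ → plus) + #⁺ b ≢ #⁻ {n} (λ _ → plus) + #⁻ b
allPlus-unbalanced {n} {n'} b n'<n balanced = <-irrefl refl (begin-strict
  #⁻ b                    ≤⟨ subst (#⁻ b ≤_) (#⁺+#⁻ b) (m≤n+m (#⁻ b) (#⁺ b)) ⟩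
  n'                      <⟨ n'<n ⟩
  n                       ≤⟨ m≤m+n n (#⁺ b) ⟩
  n + #⁺ b                ≡⟨ cong (_+ #⁺ b) (sym (#⁺-plus n)) ⟩
  #⁺ {n} (λ _ → plus) + #⁺ b  ≡⟨ balanced ⟩
  #⁻ {n} (λ _ → plus) + #⁻ b  ≡⟨ cong (_+ #⁻ b) (#⁺-minus n) ⟩
  #⁻ b                    ∎)
  where open ≤-Reasoning

pivoted-odd : ∀ {n} s {w w' : Fin (suc n) → PM} → (∀ u → w' u ≡ negPM (w u)) →
              ∀ i → pivoted (negPM s) w' i ≡ negPM (pivoted s w i)
pivoted-odd s {w} {w'} w'≡-w i =
  trans (cong (λ c → negPM s ⋆ threshold (c ∸ 1) i) (#⁺-cong (cong negPM ∘ same)))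
        (negPM-⋆ s _)
  where
    same : ∀ u → negPM s ⋆ w' u ≡ s ⋆ w u
    same u = begin
      negPM s ⋆ w' u             ≡⟨ cong (negPM s ⋆_) (w'≡-w u) ⟩
      negPM s ⋆ negPM (w u)      ≡⟨ negPM-⋆ s (negPM (w u)) ⟩
      negPM (s ⋆ negPM (w u))    ≡⟨ cong negPM (⋆-negPM s (w u)) ⟩
      negPM (negPM (s ⋆ w u))    ≡⟨ negPM-involutive (s ⋆ w u) ⟩
      s ⋆ w u                    ∎
      where open ≡-Reasoning

balancer-odd : ∀ {n} {w w' : Fin (suc n) → PM} → (∀ u → w' u ≡ negPM (w u)) →
               ∀ i → balancer w' i ≡ negPM (balancer w i)
balancer-odd {w = w} {w'} w'≡-w i =
  trans (cong (λ s → pivoted s w' i) (w'≡-w zero)) (pivoted-odd (w zero) w'≡-w i)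

module Residues (L : ℕ) {{_ : NonZero L}} where

  infixl 6 _⊕_
  infix  8 -_

  ⟦_⟧ : ℕ → Fin L
  ⟦ k ⟧ = fromℕ< (m%n<n k L)

  0ₗ : Fin L
  0ₗ = ⟦ 0 ⟧

  _⊕_ : Op₂ (Fin L)
  _⊕_ = addZ L

  -_ : Op₁ (Fin L)
  -_ = negZ L

  toℕ-⟦⟧ : ∀ k → toℕ ⟦ k ⟧ ≡ k % L
  toℕ-⟦⟧ k = toℕ-fromℕ< (m%n<n k L)

  ⟦⟧-cong : ∀ {k k'} → k % L ≡ k' % L → ⟦ k ⟧ ≡ ⟦ k' ⟧
  ⟦⟧-cong {k} {k'} eq = toℕ-injective (trans (toℕ-⟦⟧ k) (trans eq (sym (toℕ-⟦⟧ k'))))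

  ⟦toℕ⟧ : ∀ a → ⟦ toℕ a ⟧ ≡ a
  ⟦toℕ⟧ a = toℕ-injective (trans (toℕ-⟦⟧ (toℕ a)) (m<n⇒m%n≡m (toℕ<n a)))

  ⟦⟧-injective : ∀ {k k'} → k < L → k' < L → ⟦ k ⟧ ≡ ⟦ k' ⟧ → k ≡ k'
  ⟦⟧-injective {k} {k'} k<L k'<L eq = begin
    k             ≡⟨ sym (m<n⇒m%n≡m k<L) ⟩
    k % L         ≡⟨ sym (toℕ-⟦⟧ k) ⟩
    toℕ ⟦ k ⟧     ≡⟨ cong toℕ eq ⟩
    toℕ ⟦ k' ⟧    ≡⟨ toℕ-⟦⟧ k' ⟩
    k' % L        ≡⟨ m<n⇒m%n≡m k'<L ⟩
    k'            ∎
    where open ≡-Reasoning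

  ⟦⟧-homo : ∀ k k' → ⟦ k + k' ⟧ ≡ ⟦ k ⟧ ⊕ ⟦ k' ⟧
  ⟦⟧-homo k k' = ⟦⟧-cong (begin
    (k + k') % L                   ≡⟨ %-distribˡ-+ k k' L ⟩
    (k % L + k' % L) % L           ≡⟨ cong₂ (λ a b → (a + b) % L) (sym (toℕ-⟦⟧ k)) (sym (toℕ-⟦⟧ k')) ⟩
    (toℕ ⟦ k ⟧ + toℕ ⟦ k' ⟧) % L   ∎)
    where open ≡-Reasoning

  ⟦L⟧ : ⟦ L ⟧ ≡ 0ₗ
  ⟦L⟧ = ⟦⟧-cong (trans (n%n≡0 L) (sym (m<n⇒m%n≡m (>-nonZero⁻¹ L))))

  ⊕-assoc : ∀ a b c → (a ⊕ b) ⊕ c ≡ a ⊕ (b ⊕ c)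
  ⊕-assoc a b c = begin
    (a ⊕ b) ⊕ c                          ≡⟨ cong ((a ⊕ b) ⊕_) (sym (⟦toℕ⟧ c)) ⟩
    ⟦ toℕ a + toℕ b ⟧ ⊕ ⟦ toℕ c ⟧        ≡⟨ sym (⟦⟧-homo (toℕ a + toℕ b) (toℕ c)) ⟩
    ⟦ toℕ a + toℕ b + toℕ c ⟧            ≡⟨ cong ⟦_⟧ (+-assoc (toℕ a) (toℕ b) (toℕ c)) ⟩
    ⟦ toℕ a + (toℕ b + toℕ c) ⟧          ≡⟨ ⟦⟧-homo (toℕ a) (toℕ b + toℕ c) ⟩
    ⟦ toℕ a ⟧ ⊕ (b ⊕ c)                  ≡⟨ cong (_⊕ (b ⊕ c)) (⟦toℕ⟧ a) ⟩
    a ⊕ (b ⊕ c)                          ∎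
    where open ≡-Reasoning

  ⊕-comm : ∀ a b → a ⊕ b ≡ b ⊕ a
  ⊕-comm a b = cong ⟦_⟧ (+-comm (toℕ a) (toℕ b))

  ⊕-identityˡ : ∀ a → 0ₗ ⊕ a ≡ a
  ⊕-identityˡ a = begin
    0ₗ ⊕ a              ≡⟨ cong (0ₗ ⊕_) (sym (⟦toℕ⟧ a)) ⟩
    ⟦ 0 ⟧ ⊕ ⟦ toℕ a ⟧   ≡⟨ sym (⟦⟧-homo 0 (toℕ a)) ⟩
    ⟦ toℕ a ⟧           ≡⟨ ⟦toℕ⟧ a ⟩
    a                   ∎
    where open ≡-Reasoning

  ⊕-inverseʳ : ∀ a → a ⊕ - a ≡ 0ₗ
  ⊕-inverseʳ a = begin
    a ⊕ - a                           ≡⟨ cong (_⊕ - a) (sym (⟦toℕ⟧ a)) ⟩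
    ⟦ toℕ a ⟧ ⊕ ⟦ L ∸ toℕ a ⟧         ≡⟨ sym (⟦⟧-homo (toℕ a) (L ∸ toℕ a)) ⟩
    ⟦ toℕ a + (L ∸ toℕ a) ⟧           ≡⟨ cong ⟦_⟧ (m+[n∸m]≡n (<⇒≤ (toℕ<n a))) ⟩
    ⟦ L ⟧                             ≡⟨ ⟦L⟧ ⟩
    0ₗ                                ∎
    where open ≡-Reasoning

  isAbelianGroup : IsAbelianGroup _≡_ _⊕_ 0ₗ -_
  isAbelianGroup = record
    { isGroup = record
      { isMonoid = record
        { isSemigroup = record
          { isMagma = record { isEquivalence = isEquivalence ; ∙-cong = cong₂ _⊕_ }
          ; assoc   = ⊕-assoc }
        ; identity = ⊕-identityˡ , λ a → trans (⊕-comm a 0ₗ) (⊕-identityˡ a) }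
      ; inverse = (λ a → trans (⊕-comm (- a) a) (⊕-inverseʳ a)) , ⊕-inverseʳ
      ; ⁻¹-cong = cong -_ }
    ; comm = ⊕-comm }

  abelianGroup : AbelianGroup 0ℓ 0ℓ
  abelianGroup = record { isAbelianGroup = isAbelianGroup }

  finAbGroup : FinAbGroup
  finAbGroup = record { isAbelianGroup = isAbelianGroup ; card = L ; enum = ↔-id (Fin L) }

  open AbelianGroup abelianGroup public
    using (commutativeSemigroup; commutativeMonoid)
    renaming (identityʳ to ⊕-identityʳ; inverseˡ to ⊕-inverseˡ)
  open AbelianGroupProperties abelianGroup public
    using ( ⁻¹-∙-comm; ⁻¹-involutive; x∙y⁻¹≈ε⇒x≈y; x≈y⇒x∙y⁻¹≈ε; y≈x\\z
          ; identityʳ-unique; \\-leftDividesˡ)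
  open CommutativeSemigroupProperties commutativeSemigroup public
    using (interchange; x∙yz≈y∙xz)
  open Summation commutativeMonoid public
    using (sum; sum-cong-≗; ∑-distrib-+)

  IsSign : Fin L → Set
  IsSign a = a ≡ oneZ L ⊎ a ≡ minusOneZ L

  pmZ-negPM : ∀ t → pmZ L (negPM t) ≡ - pmZ L t
  pmZ-negPM minus = sym (⁻¹-involutive (oneZ L))
  pmZ-negPM plus  = refl

  pmZ-isSign : ∀ t → IsSign (pmZ L t)
  pmZ-isSign minus = inj₂ refl
  pmZ-isSign plus  = inj₁ refl

  isSign⇒pmZ : ∀ {a} → IsSign a → ∃[ t ] pmZ L t ≡ a
  isSign⇒pmZ (inj₁ refl) = plus , refl
  isSign⇒pmZ (inj₂ refl) = minus , refl

  signMul : PM → Op₁ (Fin L)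
  signMul minus a = - a
  signMul plus  a = a

  signMul-pmZ : ∀ s t → signMul s (pmZ L t) ≡ pmZ L (s ⋆ t)
  signMul-pmZ minus t = sym (pmZ-negPM t)
  signMul-pmZ plus  t = refl

  signMul-homo : ∀ s a b → signMul s (a ⊕ b) ≡ signMul s a ⊕ signMul s b
  signMul-homo minus a b = sym (⁻¹-∙-comm a b)
  signMul-homo plus  a b = refl

  module _ (2<L : 2 < L) where

    1≢-1 : oneZ L ≢ minusOneZ L
    1≢-1 1≡-1 = contradiction (⟦⟧-injective 2<L (>-nonZero⁻¹ L) ⟦2⟧≡⟦0⟧) (λ ())
      where
        ⟦2⟧≡⟦0⟧ : ⟦ 2 ⟧ ≡ ⟦ 0 ⟧
        ⟦2⟧≡⟦0⟧ = begin
          ⟦ 2 ⟧                 ≡⟨ ⟦⟧-homo 1 1 ⟩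
          oneZ L ⊕ oneZ L       ≡⟨ cong (oneZ L ⊕_) 1≡-1 ⟩
          oneZ L ⊕ minusOneZ L  ≡⟨ ⊕-inverseʳ (oneZ L) ⟩
          ⟦ 0 ⟧                 ∎
          where open ≡-Reasoning

    pmZ-injective : ∀ {s t} → pmZ L s ≡ pmZ L t → s ≡ t
    pmZ-injective {minus} {minus} _ = refl
    pmZ-injective {minus} {plus}  eq = contradiction (sym eq) 1≢-1
    pmZ-injective {plus}  {minus} eq = contradiction eq 1≢-1
    pmZ-injective {plus}  {plus}  _ = refl

    isSign-dichotomy : ∀ {a b} → IsSign a → IsSign b → b ≡ a ⊎ b ≡ - a
    isSign-dichotomy (inj₁ refl) (inj₁ refl) = inj₁ refl
    isSign-dichotomy (inj₁ refl) (inj₂ refl) = inj₂ refl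
    isSign-dichotomy (inj₂ refl) (inj₁ refl) = inj₂ (sym (⁻¹-involutive (oneZ L)))
    isSign-dichotomy (inj₂ refl) (inj₂ refl) = inj₁ refl

    isSign⇒≢- : ∀ {a} → IsSign a → a ≢ - a
    isSign⇒≢- (inj₁ refl) = 1≢-1
    isSign⇒≢- (inj₂ refl) eq = 1≢-1 (sym (trans eq (⁻¹-involutive (oneZ L))))

  isSign-neg : ∀ {a} → IsSign a → IsSign (- a)
  isSign-neg (inj₁ refl) = inj₂ refl
  isSign-neg (inj₂ refl) = inj₁ (⁻¹-involutive (oneZ L))

  sum-pmZ : ∀ {n} (f : Fin n → PM) → sum (pmZ L ∘ f) ≡ ⟦ #⁺ f ⟧ ⊕ - ⟦ #⁻ f ⟧
  sum-pmZ {zero}  f = sym (⊕-inverseʳ 0ₗ)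
  sum-pmZ {suc n} f with f zero | sum-pmZ (f ∘ suc)
  ... | plus | ih = begin
    ⟦ 1 ⟧ ⊕ sum (pmZ L ∘ f ∘ suc)   ≡⟨ cong (⟦ 1 ⟧ ⊕_) ih ⟩
    ⟦ 1 ⟧ ⊕ (⟦ P ⟧ ⊕ - ⟦ M ⟧)       ≡⟨ sym (⊕-assoc ⟦ 1 ⟧ ⟦ P ⟧ (- ⟦ M ⟧)) ⟩
    ⟦ 1 ⟧ ⊕ ⟦ P ⟧ ⊕ - ⟦ M ⟧         ≡⟨ cong (_⊕ - ⟦ M ⟧) (sym (⟦⟧-homo 1 P)) ⟩
    ⟦ 1 + P ⟧ ⊕ - ⟦ M ⟧             ∎
    where
      open ≡-Reasoning
      P = #⁺ (f ∘ suc)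
      M = #⁻ (f ∘ suc)
  ... | minus | ih = begin
    - ⟦ 1 ⟧ ⊕ sum (pmZ L ∘ f ∘ suc)  ≡⟨ cong (- ⟦ 1 ⟧ ⊕_) ih ⟩
    - ⟦ 1 ⟧ ⊕ (⟦ P ⟧ ⊕ - ⟦ M ⟧)      ≡⟨ x∙yz≈y∙xz (- ⟦ 1 ⟧) ⟦ P ⟧ (- ⟦ M ⟧) ⟩
    ⟦ P ⟧ ⊕ (- ⟦ 1 ⟧ ⊕ - ⟦ M ⟧)      ≡⟨ cong (⟦ P ⟧ ⊕_) (⁻¹-∙-comm ⟦ 1 ⟧ ⟦ M ⟧) ⟩
    ⟦ P ⟧ ⊕ - (⟦ 1 ⟧ ⊕ ⟦ M ⟧)        ≡⟨ cong (λ c → ⟦ P ⟧ ⊕ - c) (sym (⟦⟧-homo 1 M)) ⟩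
    ⟦ P ⟧ ⊕ - ⟦ 1 + M ⟧              ∎
    where
      open ≡-Reasoning
      P = #⁺ (f ∘ suc)
      M = #⁻ (f ∘ suc)

  signSums≡0⇔balanced : ∀ {n n'} (f : Fin n → PM) (g : Fin n' → PM) → n + n' < L →
                        (sum (pmZ L ∘ f) ⊕ sum (pmZ L ∘ g) ≡ 0ₗ) ⇔ (#⁺ f + #⁺ g ≡ #⁻ f + #⁻ g)
  signSums≡0⇔balanced {n} {n'} f g n+n'<L = mk⇔
    (λ sums≡0 → ⟦⟧-injective (bound (#⁺≤ f) (#⁺≤ g)) (bound (#⁻≤ f) (#⁻≤ g))
                  (x∙y⁻¹≈ε⇒x≈y _ _ (trans (sym sums≡difference) sums≡0)))
    (λ balanced → trans sums≡difference (x≈y⇒x∙y⁻¹≈ε (cong ⟦_⟧ balanced)))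
    where
      open ≡-Reasoning
      #⁺≤ : ∀ {k} (h : Fin k → PM) → #⁺ h ≤ k
      #⁺≤ h = subst (#⁺ h ≤_) (#⁺+#⁻ h) (m≤m+n _ _)
      #⁻≤ : ∀ {k} (h : Fin k → PM) → #⁻ h ≤ k
      #⁻≤ h = subst (#⁻ h ≤_) (#⁺+#⁻ h) (m≤n+m _ _)
      bound : ∀ {a b} → a ≤ n → b ≤ n' → a + b < L
      bound a≤n b≤n' = ≤-<-trans (+-mono-≤ a≤n b≤n') n+n'<L
      sums≡difference : sum (pmZ L ∘ f) ⊕ sum (pmZ L ∘ g) ≡ ⟦ #⁺ f + #⁺ g ⟧ ⊕ - ⟦ #⁻ f + #⁻ g ⟧
      sums≡difference = begin
        sum (pmZ L ∘ f) ⊕ sum (pmZ L ∘ g)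
          ≡⟨ cong₂ _⊕_ (sum-pmZ f) (sum-pmZ g) ⟩
        (⟦ #⁺ f ⟧ ⊕ - ⟦ #⁻ f ⟧) ⊕ (⟦ #⁺ g ⟧ ⊕ - ⟦ #⁻ g ⟧)
          ≡⟨ interchange ⟦ #⁺ f ⟧ (- ⟦ #⁻ f ⟧) ⟦ #⁺ g ⟧ (- ⟦ #⁻ g ⟧) ⟩
        (⟦ #⁺ f ⟧ ⊕ ⟦ #⁺ g ⟧) ⊕ (- ⟦ #⁻ f ⟧ ⊕ - ⟦ #⁻ g ⟧)
          ≡⟨ cong₂ _⊕_ (sym (⟦⟧-homo (#⁺ f) (#⁺ g))) (⁻¹-∙-comm ⟦ #⁻ f ⟧ ⟦ #⁻ g ⟧) ⟩
        ⟦ #⁺ f + #⁺ g ⟧ ⊕ - (⟦ #⁻ f ⟧ ⊕ ⟦ #⁻ g ⟧)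
          ≡⟨ cong (λ c → ⟦ #⁺ f + #⁺ g ⟧ ⊕ - c) (sym (⟦⟧-homo (#⁻ f) (#⁻ g))) ⟩
        ⟦ #⁺ f + #⁺ g ⟧ ⊕ - ⟦ #⁻ f + #⁻ g ⟧
          ∎

fromBit : Fin 2 → PM
fromBit zero    = plus
fromBit (suc _) = minus

toBit : PM → Fin 2
toBit minus = suc zero
toBit plus  = zero

signVector : ∀ {n} → Fin (2 ^ n) → Fin n → PM
signVector k = fromBit ∘ finToFun k

signIndex : ∀ {n} → (Fin n → PM) → Fin (2 ^ n)
signIndex s = funToFin (toBit ∘ s)

signVector-signIndex : ∀ {n} (s : Fin n → PM) u → signVector (signIndex s) u ≡ s u
signVector-signIndex s u = trans (cong fromBit (finToFun-funToFin (toBit ∘ s) u)) (fromBit-toBit (s u))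
  where
    fromBit-toBit : ∀ t → fromBit (toBit t) ≡ t
    fromBit-toBit minus = refl
    fromBit-toBit plus  = refl

module _ {A : Tgt} where
  open Tgt A

  lookup : ∀ {n} → ProdC n (λ _ → A) → Fin n → Carrier
  lookup {suc n} (a , _)  zero    = a
  lookup {suc n} (_ , as) (suc i) = lookup as i

  lookup-pack : ∀ {n} (f : Fin n → Carrier) i → lookup (pack n (λ _ → A) f) i ≡ f i
  lookup-pack {suc n} f zero    = refl
  lookup-pack {suc n} f (suc i) = lookup-pack (f ∘ suc) i

  lookup-prodAdd : ∀ {n} (a b : ProdC n (λ _ → A)) i →
                   lookup (prodAdd n (λ _ → A) a b) i ≡ lookup a i ⊕ lookup b i
  lookup-prodAdd {suc n} (a , as) (b , bs) zero    = refl
  lookup-prodAdd {suc n} (a , as) (b , bs) (suc i) = lookup-prodAdd as bs i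

  lookup-injective : ∀ {n} {a b : ProdC n (λ _ → A)} → (∀ i → lookup a i ≡ lookup b i) → a ≡ b
  lookup-injective {zero}                    eq = refl
  lookup-injective {suc n} {a , as} {b , bs} eq = cong₂ _,_ (eq zero) (lookup-injective (eq ∘ suc))

module Tiling (G : FGAbGroup) (T : Tgt) (L : ℕ) {{_ : NonZero L}}
    (𝟘 : Tgt.Carrier T) (_⊖_ : Op₂ (Tgt.Carrier T))
    (⊕ᵀ-identityʳ : ∀ y → Tgt._⊕_ T y 𝟘 ≡ y)
    (⊕ᵀ-⊖ : ∀ p y → Tgt._⊕_ T p (y ⊖ p) ≡ y) where

  open FGAbGroup G using (_∙_; ε) renaming (Carrier to X)
  open Tgt T using () renaming (Carrier to C; _⊕_ to _⊕ᵀ_)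
  open Residues L

  ∙-identityʳ : ∀ x → x ∙ ε ≡ x
  ∙-identityʳ = IsAbelianGroup.identityʳ (FGAbGroup.isAbelianGroup G)

  Additive : (C → Fin L) → Set
  Additive f = ∀ a b → f (a ⊕ᵀ b) ≡ f a ⊕ f b

  module _ {f : C → Fin L} (f-additive : Additive f) where

    additive-𝟘 : f 𝟘 ≡ 0ₗ
    additive-𝟘 = identityʳ-unique (f 𝟘) (f 𝟘) (trans (sym (f-additive 𝟘 𝟘)) (cong f (⊕ᵀ-identityʳ 𝟘)))

    additive-⊖ : ∀ y p → f (y ⊖ p) ≡ - f p ⊕ f y
    additive-⊖ y p = y≈x\\z (f p) (f (y ⊖ p)) (f y) (trans (sym (f-additive p (y ⊖ p))) (cong f (⊕ᵀ-⊖ p y)))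

    translate-kernel : ∀ p y → InTranslate T p (λ z → f z ≡ 0ₗ) y ⇔ (f y ≡ f p)
    translate-kernel p y = mk⇔
      (λ { (z , fz≡0 , refl) → trans (f-additive p z) (trans (cong (f p ⊕_) fz≡0) (⊕-identityʳ (f p))) })
      (λ fy≡fp → y ⊖ p
               , trans (additive-⊖ y p) (trans (cong (- f p ⊕_) fy≡fp) (⊕-inverseˡ (f p)))
               , sym (⊕ᵀ-⊖ p y))

  ⊕-additive : ∀ f g → Additive f → Additive g → Additive (λ y → f y ⊕ g y)
  ⊕-additive f g f-additive g-additive a b =
    trans (cong₂ _⊕_ (f-additive a b) (g-additive a b)) (interchange (f a) (f b) (g a) (g b))

  sum-additive : ∀ {n} (f : Fin n → C → Fin L) → (∀ i → Additive (f i)) →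
                 Additive (λ y → sum (λ i → f i y))
  sum-additive f f-additive a b =
    trans (sum-cong-≗ (λ i → f-additive i a b)) (∑-distrib-+ (λ i → f i a) (λ i → f i b))

  signMul-additive : ∀ s {f} → Additive f → Additive (signMul s ∘ f)
  signMul-additive s {f} f-additive a b = trans (cong (signMul s) (f-additive a b)) (signMul-homo s (f a) (f b))

  record IsSubgroup (S : Subset C) : Set where
    field
      𝟘∈       : S 𝟘
      ⊕-closed : ∀ {a b} → S a → S b → S (a ⊕ᵀ b)
      ⊖-closed : ∀ {a b} → S a → S b → S (a ⊖ b)

  InKernelsOutside : {K : Set} → Subset K → (K → C → Fin L) → Subset C
  InKernelsOutside Q f y = ∀ k → f k y ≡ 0ₗ ⊎ Q k

  inKernelsOutside-isSubgroup : ∀ {K : Set} (Q : Subset K) {f : K → C → Fin L} →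
                                (∀ k → Additive (f k)) → IsSubgroup (InKernelsOutside Q f)
  inKernelsOutside-isSubgroup Q {f} f-additive = record
    { 𝟘∈       = λ k → inj₁ (additive-𝟘 (f-additive k))
    ; ⊕-closed = ⊕-closed
    ; ⊖-closed = ⊖-closed
    }
    where
      S = InKernelsOutside Q f

      ⊕-closed : ∀ {a b} → S a → S b → S (a ⊕ᵀ b)
      ⊕-closed {a} {b} Sa Sb k with Sa k | Sb k
      ... | inj₂ q     | _          = inj₂ q
      ... | inj₁ _     | inj₂ q     = inj₂ q
      ... | inj₁ fa≡0 | inj₁ fb≡0 =
        inj₁ (trans (f-additive k a b) (trans (cong₂ _⊕_ fa≡0 fb≡0) (⊕-identityʳ 0ₗ)))

      ⊖-closed : ∀ {a b} → S a → S b → S (a ⊖ b)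
      ⊖-closed {a} {b} Sa Sb k with Sa k | Sb k
      ... | inj₂ q     | _          = inj₂ q
      ... | inj₁ _     | inj₂ q     = inj₂ q
      ... | inj₁ fa≡0 | inj₁ fb≡0 =
        inj₁ (trans (additive-⊖ (f-additive k) a b)
                    (trans (cong₂ (λ u v → - u ⊕ v) fb≡0 fa≡0) (⊕-inverseˡ 0ₗ)))

  translate-subgroup : ∀ {S} → IsSubgroup S → ∀ {p} → S p → ∀ y → InTranslate T p S y ⇔ S y
  translate-subgroup {S} S-subgroup {p} Sp y = mk⇔
    (λ { (z , Sz , refl) → ⊕-closed Sp Sz })
    (λ Sy → y ⊖ p , ⊖-closed Sy Sp , sym (⊕ᵀ-⊖ p y))
    where open IsSubgroup S-subgroup

  record Row : Set₁ where
    field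
      J  : ℕ
      E' : Subset C
      h  : Fin J → X
      E  : Fin J → Subset C

  rows : (M : ℕ) → (Fin M → Row) → ExprData G T
  rows M R = record { M = M ; J = Row.J ∘ R ; E' = Row.E' ∘ R ; h = Row.h ∘ R ; E = Row.E ∘ R }

  RowTiles : Row → (X → C) → X → Set
  RowTiles ρ γ x = Tiles G T (rows 1 (λ _ → ρ)) γ zero x

  subgroupRow : Subset C → Row
  subgroupRow S = record { J = 1 ; E' = S ; h = λ _ → ε ; E = λ _ → S }

  subgroupRow-tiles : ∀ {S} → IsSubgroup S → ∀ γ x → RowTiles (subgroupRow S) γ x ⇔ S (γ x)
  subgroupRow-tiles {S} S-subgroup γ x = mk⇔
    (λ (cover , _) → Equivalence.from (cover (γ x)) (zero , 𝟘 , 𝟘∈ , γx≡γx∙ε⊕𝟘))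
    (λ Sγx → (λ y → translates≡S y Sγx) , λ { zero zero 0≢0 → contradiction refl 0≢0 })
    where
      open IsSubgroup S-subgroup
      γx≡γx∙ε⊕𝟘 : γ x ≡ γ (x ∙ ε) ⊕ᵀ 𝟘
      γx≡γx∙ε⊕𝟘 = trans (sym (⊕ᵀ-identityʳ (γ x))) (cong (λ x' → γ x' ⊕ᵀ 𝟘) (sym (∙-identityʳ x)))
      translates≡S : ∀ y → S (γ x) → S y ⇔ (∃[ j ] InTranslate T (γ (x ∙ ε)) S y)
      translates≡S y Sγx = mk⇔ (λ Sy → zero , Equivalence.from translate Sy) (Equivalence.to translate ∘ proj₂)
        where
          translate : InTranslate T (γ (x ∙ ε)) S y ⇔ S y
          translate = translate-subgroup S-subgroup (subst S (cong γ (sym (∙-identityʳ x))) Sγx) y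

  shifts : X → Fin 2 → X
  shifts e zero    = ε
  shifts e (suc _) = e

  signRow : X → (C → Fin L) → Row
  signRow e f = record { J = 2 ; E' = IsSign ∘ f ; h = shifts e ; E = λ _ z → f z ≡ 0ₗ }

  signRow-tiles : 2 < L → ∀ e {f} → Additive f → ∀ γ x →
                  RowTiles (signRow e f) γ x ⇔ (IsSign (f (γ x)) × f (γ (x ∙ e)) ≡ - f (γ x))
  signRow-tiles 2<L e {f} f-additive γ x = mk⇔ elim intro
    where
      a : Fin 2 → Fin L
      a j = f (γ (x ∙ shifts e j))

      a₀≡ : a zero ≡ f (γ x)
      a₀≡ = cong (f ∘ γ) (∙-identityʳ x)

      Translate : Fin 2 → Subset C
      Translate j = InTranslate T (γ (x ∙ shifts e j)) (λ z → f z ≡ 0ₗ)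

      member : ∀ j y → Translate j y ⇔ (f y ≡ a j)
      member j = translate-kernel f-additive (γ (x ∙ shifts e j))

      intro : IsSign (f (γ x)) × f (γ (x ∙ e)) ≡ - f (γ x) → RowTiles (signRow e f) γ x
      intro (sign , odd) = (λ y → mk⇔ (cover y) (covered y)) , disjoint
        where
          a-isSign : ∀ j → IsSign (a j)
          a-isSign zero       = subst IsSign (sym a₀≡) sign
          a-isSign (suc zero) = subst IsSign (sym odd) (isSign-neg sign)

          cover : ∀ y → IsSign (f y) → ∃[ j ] Translate j y
          cover y fy-isSign with isSign-dichotomy 2<L sign fy-isSign
          ... | inj₁ fy≡a₀  = zero , Equivalence.from (member zero y) (trans fy≡a₀ (sym a₀≡))
          ... | inj₂ fy≡-a₀ = suc zero , Equivalence.from (member (suc zero) y) (trans fy≡-a₀ (sym odd))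

          covered : ∀ y → ∃[ j ] Translate j y → IsSign (f y)
          covered y (j , t) = subst IsSign (sym (Equivalence.to (member j y) t)) (a-isSign j)

          a₀≢a₁ : a zero ≢ a (suc zero)
          a₀≢a₁ eq = isSign⇒≢- 2<L sign (trans (sym a₀≡) (trans eq odd))

          disjoint : ∀ j j' → j ≢ j' → ∀ y → ¬ (Translate j y × Translate j' y)
          disjoint zero       zero       j≢j' _ _ = j≢j' refl
          disjoint (suc zero) (suc zero) j≢j' _ _ = j≢j' refl
          disjoint zero (suc zero) _ y (t , t') =
            a₀≢a₁ (trans (sym (Equivalence.to (member zero y) t)) (Equivalence.to (member (suc zero) y) t'))
          disjoint (suc zero) zero _ y (t , t') =
            a₀≢a₁ (trans (sym (Equivalence.to (member zero y) t')) (Equivalence.to (member (suc zero) y) t))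

      elim : RowTiles (signRow e f) γ x → IsSign (f (γ x)) × f (γ (x ∙ e)) ≡ - f (γ x)
      elim (cover , disjoint) = sign , odd
        where
          inTranslate₀ : Translate zero (γ x)
          inTranslate₀ = Equivalence.from (member zero (γ x)) (sym a₀≡)

          sign : IsSign (f (γ x))
          sign = Equivalence.from (cover (γ x)) (zero , inTranslate₀)

          sign₁ : IsSign (f (γ (x ∙ e)))
          sign₁ = Equivalence.from (cover (γ (x ∙ e)))
                    (suc zero , Equivalence.from (member (suc zero) (γ (x ∙ e))) refl)

          odd : f (γ (x ∙ e)) ≡ - f (γ x)
          odd with isSign-dichotomy 2<L sign sign₁
          ... | inj₂ a₁≡-a₀ = a₁≡-a₀
          ... | inj₁ a₁≡a₀  = contradiction
            (inTranslate₀ , Equivalence.from (member (suc zero) (γ x)) (sym a₁≡a₀))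
            (disjoint zero (suc zero) (λ ()) (γ x))

EBoolean-cong : ∀ G e {L} {{_ : NonZero L}} {f g : FGAbGroup.Carrier G → Fin L} →
                (∀ x → f x ≡ g x) → EBoolean G e L f → EBoolean G e L g
EBoolean-cong G e {L} f≡g f-boolean x =
  subst (λ a → a ≡ oneZ L ⊎ a ≡ minusOneZ L) (f≡g x) (proj₁ (f-boolean x)) ,
  trans (sym (f≡g (FGAbGroup._∙_ G x e))) (trans (proj₂ (f-boolean x)) (cong (negZ L) (f≡g x)))

module Construction (G : FGAbGroup) (e : FGAbGroup.Carrier G) (n : ℕ)
    (Ω : Subset (Fin (suc n) → PM)) (Ω-neg : ∀ ω → Ω ω ⇔ Ω (negPM ∘ ω))
    (L : ℕ) {{_ : NonZero L}} (L-large : 2 * suc n < L) where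

  open FGAbGroup G using (_∙_) renaming (Carrier to X)
  open Residues L

  U B K m : ℕ
  U = suc n
  B = n ∸ 1
  K = 2 ^ U
  m = K * B

  2<L : 2 < L
  2<L = ≤-<-trans (*-monoʳ-≤ 2 (s≤s z≤n)) L-large

  U+B<L : U + B < L
  U+B<L = begin-strict
    U + (n ∸ 1)   ≤⟨ +-monoʳ-≤ U (≤-trans (m∸n≤m n 1) (n≤1+n n)) ⟩
    U + U         ≡⟨ cong (U +_) (sym (+-identityʳ U)) ⟩
    2 * U         <⟨ L-large ⟩
    L             ∎
    where open ≤-Reasoning

  ℤ/L : Tgt
  ℤ/L = ZLT L

  Power : ℕ → Set
  Power k = ProdC k (λ _ → ℤ/L)

  T : Tgt
  T = ProdT U (λ _ → ℤ/L) ×T ProdT m (λ _ → finTgt finAbGroup)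

  C : Set
  C = Tgt.Carrier T

  𝟘ᵛ : ∀ {k} → Power k
  𝟘ᵛ {k} = pack k (λ _ → ℤ/L) (λ _ → 0ₗ)

  _⊖ᵛ_ : ∀ {k} → Op₂ (Power k)
  _⊖ᵛ_ {k} y p = pack k (λ _ → ℤ/L) (λ i → - lookup p i ⊕ lookup y i)

  ⊕ᵛ-identityʳ : ∀ {k} (y : Power k) → prodAdd k (λ _ → ℤ/L) y 𝟘ᵛ ≡ y
  ⊕ᵛ-identityʳ {k} y = lookup-injective λ i →
    trans (lookup-prodAdd y 𝟘ᵛ i)
          (trans (cong (lookup y i ⊕_) (lookup-pack {A = ℤ/L} (λ _ → 0ₗ) i)) (⊕-identityʳ (lookup y i)))

  ⊕ᵛ-⊖ᵛ : ∀ {k} (p y : Power k) → prodAdd k (λ _ → ℤ/L) p (y ⊖ᵛ p) ≡ y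
  ⊕ᵛ-⊖ᵛ {k} p y = lookup-injective λ i →
    trans (lookup-prodAdd p (y ⊖ᵛ p) i)
          (trans (cong (lookup p i ⊕_) (lookup-pack {A = ℤ/L} (λ i → - lookup p i ⊕ lookup y i) i))
                 (\\-leftDividesˡ (lookup p i) (lookup y i)))

  𝟘 : C
  𝟘 = 𝟘ᵛ , 𝟘ᵛ

  _⊖_ : Op₂ C
  y ⊖ p = proj₁ y ⊖ᵛ proj₁ p , proj₂ y ⊖ᵛ proj₂ p

  open Tiling G T L 𝟘 _⊖_
    (λ y → cong₂ _,_ (⊕ᵛ-identityʳ (proj₁ y)) (⊕ᵛ-identityʳ (proj₂ y)))
    (λ p y → cong₂ _,_ (⊕ᵛ-⊖ᵛ (proj₁ p) (proj₁ y)) (⊕ᵛ-⊖ᵛ (proj₂ p) (proj₂ y)))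

  Index : Set
  Index = Fin U ⊎ Fin m

  coord : Index → C → Fin L
  coord (inj₁ u) y = lookup (proj₁ y) u
  coord (inj₂ j) y = lookup (proj₂ y) j

  coord-additive : ∀ c → Additive (coord c)
  coord-additive (inj₁ u) a b = lookup-prodAdd (proj₁ a) (proj₁ b) u
  coord-additive (inj₂ j) a b = lookup-prodAdd (proj₂ a) (proj₂ b) j

  signedPart extraPart : Fin K → C → Fin L
  signedPart k y = sum (λ u → signMul (signVector k u) (coord (inj₁ u) y))
  extraPart  k y = sum (λ i → coord (inj₂ (combine k i)) y)

  ℓ : Fin K → C → Fin L
  ℓ k y = signedPart k y ⊕ extraPart k y

  ℓ-additive : ∀ k → Additive (ℓ k)
  ℓ-additive k = ⊕-additive (signedPart k) (extraPart k)
    (sum-additive (λ u → signMul (signVector k u) ∘ coord (inj₁ u))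
                  (λ u → signMul-additive (signVector k u) (coord-additive (inj₁ u))))
    (sum-additive (λ i → coord (inj₂ (combine k i))) (λ i → coord-additive (inj₂ (combine k i))))

  -- Ω itself need not respect pointwise equality of sign vectors.
  Ω≗ : Subset (Fin U → PM)
  Ω≗ s = ∃[ ω ] Ω ω × (∀ u → ω u ≡ s u)

  Ω≗-signMultiple : ∀ {ω s c} → Ω ω → (∀ u → s u ⋆ ω u ≡ c) → Ω≗ s
  Ω≗-signMultiple {ω} {s} {plus}  Ωω s⋆ω≡c = ω , Ωω , λ u → sym (⋆-transpose (s u) (ω u) (s⋆ω≡c u))
  Ω≗-signMultiple {ω} {s} {minus} Ωω s⋆ω≡c =
    negPM ∘ ω , Equivalence.to (Ω-neg ω) Ωω , λ u → sym (⋆-transpose (s u) (ω u) (s⋆ω≡c u))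

  Φ : Subset C
  Φ = InKernelsOutside (Ω≗ ∘ signVector) ℓ

  Φ-isSubgroup : IsSubgroup Φ
  Φ-isSubgroup = inKernelsOutside-isSubgroup (Ω≗ ∘ signVector) ℓ-additive

  row : Fin (suc (U + m)) → Row
  row zero    = subgroupRow Φ
  row (suc c) = signRow e (coord (splitAt U c))

  expression : ExprData G T
  expression = rows (suc (U + m)) row

  Tiled : Property G T
  Tiled γ = ∀ i x → Tiles G T expression γ i x

  Tiled-expressible : Expressible G T Tiled
  Tiled-expressible = expression , λ _ → mk⇔ id id

  ValuesInΩ : Tuple G U (λ _ → ℤ/L) → X → Set
  ValuesInΩ α x = ∃[ ω ] (Ω ω × (∀ u → α u x ≡ pmZ L (ω u)))

  Extra : Set
  Extra = Tuple G m (λ _ → finTgt finAbGroup)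

  entry : Tuple G U (λ _ → ℤ/L) → Extra → Index → X → Fin L
  entry α β (inj₁ u) = α u
  entry α β (inj₂ j) = β j

  packed : Tuple G U (λ _ → ℤ/L) → Extra → X → C
  packed α β x = packTuple G U (λ _ → ℤ/L) α x , packTuple G m (λ _ → finTgt finAbGroup) β x

  coord-packed : ∀ α β c x → coord c (packed α β x) ≡ entry α β c x
  coord-packed α β (inj₁ u) x = lookup-pack (λ u → α u x) u
  coord-packed α β (inj₂ j) x = lookup-pack (λ j → β j x) j

  ℓ-packed : ∀ α β k x → ℓ k (packed α β x) ≡
             sum (λ u → signMul (signVector k u) (α u x)) ⊕ sum (λ i → β (combine k i) x)
  ℓ-packed α β k x =
    cong₂ _⊕_ (sum-cong-≗ (λ u → cong (signMul (signVector k u)) (coord-packed α β (inj₁ u) x)))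
              (sum-cong-≗ (λ i → coord-packed α β (inj₂ (combine k i)) x))

  Tiled⇔ : ∀ α β → Tiled (packed α β) ⇔
                   ((∀ x → Φ (packed α β x)) × (∀ c → EBoolean G e L (entry α β c)))
  Tiled⇔ α β = mk⇔
    (λ tiled → (λ x → Equivalence.to (subgroupRow-tiles Φ-isSubgroup γ x) (tiled zero x))
             , (λ c → EBoolean-cong G e (coord-packed α β c)
                        (λ x → Equivalence.to (signRow-tiles 2<L e (coord-additive c) γ x) (signTiles tiled c x))))
    (λ { (Φγ , entry-boolean) → λ
      { zero    x → Equivalence.from (subgroupRow-tiles Φ-isSubgroup γ x) (Φγ x)
      ; (suc c) x → Equivalence.from (signRow-tiles 2<L e (coord-additive (splitAt U c)) γ x)
                      (EBoolean-cong G e (sym ∘ coord-packed α β (splitAt U c)) (entry-boolean (splitAt U c)) x) } })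
    where
      γ = packed α β
      signTiles : Tiled γ → ∀ c x → RowTiles (signRow e (coord c)) γ x
      signTiles tiled c x =
        subst (λ c' → RowTiles (signRow e (coord c')) γ x) (splitAt-join U m c) (tiled (suc (join U m c)) x)

  module FromProperty (α : Tuple G U (λ _ → ℤ/L)) (α-boolean : ∀ u → EBoolean G e L (α u))
                      (α-inΩ : ∀ x → ValuesInΩ α x) where

    signs : X → Fin U → PM
    signs x = proj₁ (α-inΩ x)

    α≡signs : ∀ x u → α u x ≡ pmZ L (signs x u)
    α≡signs x = proj₂ (proj₂ (α-inΩ x))

    signs-odd : ∀ x u → signs (x ∙ e) u ≡ negPM (signs x u)
    signs-odd x u = pmZ-injective 2<L (begin
      pmZ L (signs (x ∙ e) u)     ≡⟨ sym (α≡signs (x ∙ e) u) ⟩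
      α u (x ∙ e)                 ≡⟨ proj₂ (α-boolean u x) ⟩
      - α u x                     ≡⟨ cong -_ (α≡signs x u) ⟩
      - pmZ L (signs x u)         ≡⟨ sym (pmZ-negPM (signs x u)) ⟩
      pmZ L (negPM (signs x u))   ∎)
      where open ≡-Reasoning

    agreement : Fin K → X → Fin U → PM
    agreement k x u = signVector k u ⋆ signs x u

    agreement-odd : ∀ k x u → agreement k (x ∙ e) u ≡ negPM (agreement k x u)
    agreement-odd k x u = trans (cong (signVector k u ⋆_) (signs-odd x u)) (⋆-negPM (signVector k u) (signs x u))

    balancing : Extra
    balancing j x = pmZ L (balancer (agreement (quotient {K} B j) x) (remainder {K} B j))

    balancing-combine : ∀ k x i → balancing (combine k i) x ≡ pmZ L (balancer (agreement k x) i)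
    balancing-combine k x i =
      cong (λ ki → pmZ L (balancer (agreement (proj₁ ki) x) (proj₂ ki))) (remQuot-combine {K} {B} k i)

    balancing-boolean : ∀ j → EBoolean G e L (balancing j)
    balancing-boolean j x =
      pmZ-isSign (balancer w i) ,
      trans (cong (pmZ L) (balancer-odd (agreement-odd k x) i)) (pmZ-negPM (balancer w i))
      where
        k = quotient {K} B j
        i = remainder {K} B j
        w = agreement k x

    balancing-Φ : ∀ x → Φ (packed α balancing x)
    balancing-Φ x k with constant⊎mixed (agreement k x)
    ... | inj₁ (c , agreement≡c) = inj₂ (Ω≗-signMultiple (proj₁ (proj₂ (α-inΩ x))) agreement≡c)
    ... | inj₂ (p≥1 , q≥1) = inj₁ (begin
      ℓ k (packed α balancing x)                                  ≡⟨ ℓ-packed α balancing k x ⟩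
      sum (λ u → signMul (signVector k u) (α u x)) ⊕ sum (λ i → balancing (combine k i) x)
        ≡⟨ cong₂ _⊕_ (sum-cong-≗ λ u → trans (cong (signMul (signVector k u)) (α≡signs x u))
                                              (signMul-pmZ (signVector k u) (signs x u)))
                     (sum-cong-≗ (balancing-combine k x)) ⟩
      sum (pmZ L ∘ w) ⊕ sum (pmZ L ∘ balancer w)
        ≡⟨ Equivalence.from (signSums≡0⇔balanced w (balancer w) U+B<L) (pivoted-balances (w zero) w p≥1 q≥1) ⟩
      0ₗ                                                          ∎)
      where
        open ≡-Reasoning
        w = agreement k x

    balancing-tiled : Tiled (packed α balancing)
    balancing-tiled = Equivalence.from (Tiled⇔ α balancing) (balancing-Φ , entry-boolean)
      where
        entry-boolean : ∀ c → EBoolean G e L (entry α balancing c)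
        entry-boolean (inj₁ u) = α-boolean u
        entry-boolean (inj₂ j) = balancing-boolean j

  module FromTiling (α : Tuple G U (λ _ → ℤ/L)) (β : Extra) (tiled : Tiled (packed α β)) where

    Φ-packed : ∀ x → Φ (packed α β x)
    Φ-packed = proj₁ (Equivalence.to (Tiled⇔ α β) tiled)

    entry-boolean : ∀ c → EBoolean G e L (entry α β c)
    entry-boolean = proj₂ (Equivalence.to (Tiled⇔ α β) tiled)

    entrySign : Index → X → PM
    entrySign c x = proj₁ (isSign⇒pmZ (proj₁ (entry-boolean c x)))

    pmZ-entrySign : ∀ c x → pmZ L (entrySign c x) ≡ entry α β c x
    pmZ-entrySign c x = proj₂ (isSign⇒pmZ (proj₁ (entry-boolean c x)))

    signs : X → Fin U → PM
    signs x u = entrySign (inj₁ u) x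

    extraSigns : X → Fin B → PM
    extraSigns x i = entrySign (inj₂ (combine (signIndex (signs x)) i)) x

    ℓ-signIndex : ∀ x → ℓ (signIndex (signs x)) (packed α β x) ≡
                        sum (pmZ L ∘ λ (_ : Fin U) → plus) ⊕ sum (pmZ L ∘ extraSigns x)
    ℓ-signIndex x = trans (ℓ-packed α β k x) (cong₂ _⊕_ (sum-cong-≗ squares) (sum-cong-≗ extras))
      where
        k = signIndex (signs x)
        squares : ∀ u → signMul (signVector k u) (α u x) ≡ pmZ L plus
        squares u = begin
          signMul (signVector k u) (α u x)         ≡⟨ cong₂ signMul (signVector-signIndex (signs x) u)
                                                                     (sym (pmZ-entrySign (inj₁ u) x)) ⟩
          signMul (signs x u) (pmZ L (signs x u))  ≡⟨ signMul-pmZ (signs x u) (signs x u) ⟩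
          pmZ L (signs x u ⋆ signs x u)            ≡⟨ cong (pmZ L) (⋆-self (signs x u)) ⟩
          pmZ L plus                               ∎
          where open ≡-Reasoning
        extras : ∀ i → β (combine k i) x ≡ pmZ L (extraSigns x i)
        extras i = sym (pmZ-entrySign (inj₂ (combine k i)) x)

    Ω≗-signs⇒inΩ : ∀ x → Ω≗ (signVector (signIndex (signs x))) → ValuesInΩ α x
    Ω≗-signs⇒inΩ x (ω , Ωω , ω≡) =
      ω , Ωω , λ u → trans (sym (pmZ-entrySign (inj₁ u) x))
                           (cong (pmZ L) (sym (trans (ω≡ u) (signVector-signIndex (signs x) u))))

    ℓ-signIndex≢0 : ∀ x → ℓ (signIndex (signs x)) (packed α β x) ≢ 0ₗ
    ℓ-signIndex≢0 x ℓ≡0 = allPlus-unbalanced {U} {B} (extraSigns x) (s≤s (m∸n≤m n 1))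
      (Equivalence.to (signSums≡0⇔balanced {U} {B} (λ _ → plus) (extraSigns x) U+B<L)
                      (trans (sym (ℓ-signIndex x)) ℓ≡0))

    tiled-inΩ : ∀ x → ValuesInΩ α x
    tiled-inΩ x = [ (λ ℓ≡0 → contradiction ℓ≡0 (ℓ-signIndex≢0 x)) , Ω≗-signs⇒inΩ x ]′
                  (Φ-packed x (signIndex (signs x)))

    tiled-boolOmega : BoolOmega G e U Ω L α
    tiled-boolOmega = entry-boolean ∘ inj₁ , tiled-inΩ

lemma6p12 : (G : FGAbGroup) (e : FGAbGroup.Carrier G) → HasOrder2 G e →
            (U : ℕ) → 1 ≤ U →
            (Ω : Subset (Fin U → PM)) → (∀ ω → Ω ω ⇔ Ω (negPM ∘ ω)) →
            (L : ℕ) {{_ : NonZero L}} → 2 * U + 4 < L →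
            WeaklyExpressible G U (λ _ → ZLT L) (BoolOmega G e U Ω L)
-- The construction does not use that e has order 2, and needs only 2 U < L.
lemma6p12 G e _ (suc n) _ Ω Ω-neg L L-large =
  m , (λ _ → Residues.finAbGroup L) , Tiled , Tiled-expressible ,
  λ α → mk⇔ (λ (α-boolean , α-inΩ) → FromProperty.balancing α α-boolean α-inΩ
                                    , FromProperty.balancing-tiled α α-boolean α-inΩ)
            (λ (β , tiled) → FromTiling.tiled-boolOmega α β tiled)
  where open Construction G e n Ω Ω-neg L (≤-<-trans (m≤m+n (2 * suc n) 4) L-large)
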